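{- There exists an instance with pairwise disjoint properties (every item has at most one property) such that the polytope $\{x\in\Omega_{m,n}: \sum_{i\in P_\ell}\sum_{j=1}^k x_{ij}\le U_{k\ell}\ \forall\ell\in[p],k\in[n]\}$ has a vertex that is not integral.
   Context: An instance consists of positive integers $m\ge n$, properties $P_1,\dots,P_p\subseteq[m]$, and upper bounds $U_{k\ell}\in\mathbb{Z}_{\ge 0}\cup\{\infty\}$ for $k\in[n]$, $\ell\in[p]$. $\Omega_{m,n}=\{x\in[0,1]^{m\times n}: \sum_{j=1}^n x_{ij}\le 1\ \forall i\in[m],\ \sum_{i=1}^m x_{ij}=1\ \forall j\in[n]\}$.
   Formalization: The points of $\Omega_{m,n}$ and of the polytope, including the two points and the weight in the definition of a vertex, are taken with rational entries instead of real ones. -}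

module Defs where

open import Data.Nat as ℕ using (ℕ; zero; suc)
open import Data.Fin using (Fin; toℕ)
import Data.Fin as Fin
open import Data.Bool using (Bool; true; false; if_then_else_)
open import Data.Maybe using (Maybe; just; nothing)
open import Data.Integer using (ℤ; +_)
open import Data.Unit using (⊤)
open import Data.Rational using (ℚ; 0ℚ; 1ℚ; _+_; _*_; _-_; _≤_; _<_; _/_)
open import Data.Product using (Σ; _×_; ∃)
open import Relation.Binary.PropositionalEquality using (_≡_)
open import Relation.Nullary using (¬_)

Σ[_] : (n : ℕ) → (Fin n → ℚ) → ℚ
Σ[ zero ] f = 0ℚ
Σ[ suc n ] f = f Fin.zero + Σ[ n ] (λ i → f (Fin.suc i))

-- Upper bounds in ℤ≥0 ∪ {∞}: nothing = ∞.
ℕ∞ : Set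
ℕ∞ = Maybe ℕ

-- An instance: m ≥ n ≥ 1, p properties P ℓ ⊆ [m] (as characteristic
-- functions), bounds U k ℓ for k ∈ [n], ℓ ∈ [p].  Fin n index k stands for
-- the paper's k = toℕ k + 1.
record Instance : Set where
  field
    m n p : ℕ
    n≥1   : 1 ℕ.≤ n
    m≥n   : n ℕ.≤ m
    P     : Fin p → Fin m → Bool
    U     : Fin n → Fin p → ℕ∞

Disjoint : Instance → Set
Disjoint I = ∀ (i : Fin m) (ℓ ℓ′ : Fin p) → P ℓ i ≡ true → P ℓ′ i ≡ true → ℓ ≡ ℓ′
  where open Instance I

Matrix : ℕ → ℕ → Set
Matrix m n = Fin m → Fin n → ℚ

InΩ : (m n : ℕ) → Matrix m n → Set
InΩ m n x =
  (∀ i j → (0ℚ ≤ x i j) × (x i j ≤ 1ℚ)) ×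
  (∀ i → Σ[ n ] (λ j → x i j) ≤ 1ℚ) ×
  (∀ j → Σ[ m ] (λ i → x i j) ≡ 1ℚ)

≤U : ℚ → ℕ∞ → Set
≤U q nothing  = ⊤
≤U q (just u) = q ≤ ((+ u) / 1)

InPoly : (I : Instance) → Matrix (Instance.m I) (Instance.n I) → Set
InPoly I x = InΩ m n x ×
  (∀ (ℓ : Fin p) (k : Fin n) →
     ≤U (Σ[ m ] (λ i → if P ℓ i
                        then Σ[ n ] (λ j → if toℕ j ℕ.≤ᵇ toℕ k then x i j else 0ℚ)
                        else 0ℚ))
        (U k ℓ))
  where open Instance I

IsVertex : (I : Instance) → Matrix (Instance.m I) (Instance.n I) → Set
IsVertex I x = InPoly I x ×
  (∀ (y z : Matrix (Instance.m I) (Instance.n I)) (λ′ : ℚ) →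
     InPoly I y → InPoly I z → 0ℚ < λ′ → λ′ < 1ℚ →
     (∀ i j → x i j ≡ λ′ * y i j + (1ℚ - λ′) * z i j) →
     ∀ i j → y i j ≡ z i j)

Integral : ∀ {m n} → Matrix m n → Set
Integral x = ∀ i j → ∃ λ (z : ℤ) → x i j ≡ z / 1

-- Take four items, three positions and a single property made of the last two items, which
-- may occupy at most one of the first two positions.  The matrix with rows (0,½,0), (½,0,½),
-- (0,½,½), (½,0,0) lies in the polytope.  If it is a proper convex combination of two points
-- of the polytope, both points vanish where it vanishes and satisfy with equality every
-- inequality tight at it.  Those equations (two row sums, the column sums and the bound)
-- force every remaining entry to be ½, so the matrix is a vertex, and it is not integral.
module Submission where

open import Defs
open import Data.Product using (Σ; _×_; ∃; _,_; proj₁; proj₂)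
open import Data.Rational
open import Data.Rational.Properties
open import Data.Integer as ℤ using (+_)
import Data.Integer.Properties as ℤ
open import Data.Integer.GCD using (gcd)
open import Data.Nat as ℕ using (suc; zero; s≤s; z≤n)
import Data.Nat.Properties as ℕ
open import Data.Fin as Fin using (Fin; toℕ)
open import Data.Fin.Patterns using (0F; 1F; 2F; 3F)
open import Data.Bool using (Bool; true; false; if_then_else_)
open import Data.Maybe using (just; nothing)
open import Data.Unit using (tt)
open import Data.List using (_∷_; [])
open import Level using (0ℓ)
open import Relation.Binary.PropositionalEquality
open import Relation.Nullary using (¬_)
open import Relation.Nullary.Decidable using (dec⇒maybe; True; toWitness)
open import Algebra.Properties.Group +-0-group using (∙-cancelˡ; ∙-cancelʳ)
open import Tactic.RingSolver using (solve-∀; solve)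
open import Tactic.RingSolver.Core.AlmostCommutativeRing using (AlmostCommutativeRing; fromCommutativeRing)

ℚ-ring : AlmostCommutativeRing 0ℓ 0ℓ
ℚ-ring = fromCommutativeRing +-*-commutativeRing (λ q → dec⇒maybe (0ℚ ≟ q))

mix : ℚ → ℚ → ℚ → ℚ
mix l a b = l * a + (1ℚ - l) * b

OpenUnit : ℚ → Set
OpenUnit l = 0ℚ < l × l < 1ℚ

-- The next three are stated unfolded because the ring solver does not unfold mix.
mix-idem : ∀ l a → l * a + (1ℚ - l) * a ≡ a
mix-idem = solve-∀ ℚ-ring

mix-comm : ∀ l a b → l * a + (1ℚ - l) * b ≡ (1ℚ - l) * b + (1ℚ - (1ℚ - l)) * a
mix-comm = solve-∀ ℚ-ring

mix-+ : ∀ l a b c d →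
        (l * a + (1ℚ - l) * b) + (l * c + (1ℚ - l) * d) ≡ l * (a + c) + (1ℚ - l) * (b + d)
mix-+ = solve-∀ ℚ-ring

p<q⇒0<q-p : ∀ {p q} → p < q → 0ℚ < q - p
p<q⇒0<q-p {p} {q} p<q = subst (_< q - p) (+-inverseʳ p) (+-monoˡ-< (- p) p<q)

OpenUnit-complement : ∀ {l} → OpenUnit l → OpenUnit (1ℚ - l)
OpenUnit-complement {l} (0<l , l<1) = p<q⇒0<q-p l<1 , 1-l<1
  where
  1-l<1 : 1ℚ - l < 1ℚ
  1-l<1 = subst (1ℚ - l <_) (+-identityʳ 1ℚ) (+-monoʳ-< 1ℚ (neg-antimono-< 0<l))

mix-mono-<-≤ : ∀ {l a a′ b b′} → OpenUnit l → a < a′ → b ≤ b′ → mix l a b < mix l a′ b′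
mix-mono-<-≤ {l} (0<l , l<1) a<a′ b≤b′ =
  +-mono-<-≤ (*-monoʳ-<-pos l a<a′) (*-monoˡ-≤-nonNeg (1ℚ - l) b≤b′)
  where
  instance
    _ = positive 0<l
    _ = nonNegative (<⇒≤ (p<q⇒0<q-p l<1))

mix-tight-≤ : ∀ {l a b c} → OpenUnit l → a ≤ c → b ≤ c → mix l a b ≡ c → a ≡ c
mix-tight-≤ {l} {a} {b} {c} u a≤c b≤c e = ≤-antisym a≤c (≮⇒≥ λ a<c →
  <-irrefl e (subst (mix l a b <_) (mix-idem l c) (mix-mono-<-≤ u a<c b≤c)))

mix-tight-≥ : ∀ {l a b c} → OpenUnit l → c ≤ a → c ≤ b → mix l a b ≡ c → a ≡ c
mix-tight-≥ {l} {a} {b} {c} u c≤a c≤b e = ≤-antisym (≮⇒≥ λ c<a →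
  <-irrefl (sym e) (subst (_< mix l a b) (mix-idem l c) (mix-mono-<-≤ u c<a c≤b))) c≤a

Σ-mix : ∀ l n {f g h : Fin n → ℚ} → (∀ i → f i ≡ mix l (g i) (h i)) →
        Σ[ n ] f ≡ mix l (Σ[ n ] g) (Σ[ n ] h)
Σ-mix l zero    e = sym (mix-idem l 0ℚ)
Σ-mix l (suc n) e =
  trans (cong₂ _+_ (e Fin.zero) (Σ-mix l n (λ i → e (Fin.suc i)))) (mix-+ l _ _ _ _)

if-mix : ∀ l b {a c d} → a ≡ mix l c d →
         (if b then a else 0ℚ) ≡ mix l (if b then c else 0ℚ) (if b then d else 0ℚ)
if-mix l true  e = e
if-mix l false e = sym (mix-idem l 0ℚ)

module _ (I : Instance) where
  open Instance I

  rowSum : Matrix m n → Fin m → ℚ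
  rowSum x i = Σ[ n ] (λ j → x i j)

  load : Matrix m n → Fin p → Fin n → ℚ
  load x ℓ k = Σ[ m ] (λ i → if P ℓ i
                               then Σ[ n ] (λ j → if toℕ j ℕ.≤ᵇ toℕ k then x i j else 0ℚ)
                               else 0ℚ)

  load-mix : ∀ l {x y z : Matrix m n} → (∀ i j → x i j ≡ mix l (y i j) (z i j)) →
             ∀ ℓ k → load x ℓ k ≡ mix l (load y ℓ k) (load z ℓ k)
  load-mix l e ℓ k = Σ-mix l m λ i → if-mix l (P ℓ i) (Σ-mix l n λ j →
                          if-mix l (toℕ j ℕ.≤ᵇ toℕ k) (e i j))

  record KeepsTight (x y : Matrix m n) : Set where
    field
      zeros     : ∀ i j → x i j ≡ 0ℚ → y i j ≡ 0ℚ
      fullRows  : ∀ i → rowSum x i ≡ 1ℚ → rowSum y i ≡ 1ℚ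
      fullLoads : ∀ ℓ k u → U k ℓ ≡ just u → load x ℓ k ≡ + u / 1 → load y ℓ k ≡ + u / 1

  ≤U-just : ∀ {q b u} → b ≡ just u → ≤U q b → q ≤ + u / 1
  ≤U-just refl q≤u = q≤u

  mix-keepsTight : ∀ l {x y z : Matrix m n} → OpenUnit l → InPoly I y → InPoly I z →
                   (∀ i j → x i j ≡ mix l (y i j) (z i j)) → KeepsTight x y
  mix-keepsTight l u ((bdY , rowY , _) , loadY) ((bdZ , rowZ , _) , loadZ) e = record
    { zeros     = λ i j x≡0 →
        mix-tight-≥ u (proj₁ (bdY i j)) (proj₁ (bdZ i j)) (trans (sym (e i j)) x≡0)
    ; fullRows  = λ i x≡1 →
        mix-tight-≤ u (rowY i) (rowZ i) (trans (sym (Σ-mix l n (e i))) x≡1)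
    ; fullLoads = λ ℓ k _ b x≡u →
        mix-tight-≤ u (≤U-just b (loadY ℓ k)) (≤U-just b (loadZ ℓ k))
                    (trans (sym (load-mix l e ℓ k)) x≡u)
    }

  rigid⇒vertex : ∀ {x} → InPoly I x →
                 (∀ y → InPoly I y → KeepsTight x y → ∀ i j → y i j ≡ x i j) → IsVertex I x
  rigid⇒vertex x∈P rigid = x∈P , λ y z l y∈P z∈P 0<l l<1 e i j →
    let tightY = mix-keepsTight l (0<l , l<1) y∈P z∈P e
        tightZ = mix-keepsTight (1ℚ - l) (OpenUnit-complement (0<l , l<1)) z∈P y∈P
                   (λ i j → trans (e i j) (mix-comm l (y i j) (z i j)))
    in trans (rigid y y∈P tightY i j) (sym (rigid z z∈P tightZ i j))

-- The denominator of z / 1 divides 1, that of ½ is 2.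
½-not-integer : ∀ z → ½ ≢ z / 1
½-not-integer z ½≡z =
  2*g≢1 (gcd z (+ 1)) (subst (λ q → ↧ q ℤ.* gcd z (+ 1) ≡ + 1) (sym ½≡z) (↧-/ z 1))
  where
  2*g≢1 : ∀ g → + 2 ℤ.* g ≢ + 1
  2*g≢1 g 2g≡1 with ℕ.m*n≡1⇒m≡1 2 ℤ.∣ g ∣ (trans (sym (ℤ.abs-* (+ 2) g)) (cong ℤ.∣_∣ 2g≡1))
  ... | ()

twice⇒½ : ∀ {a} → a + a ≡ 1ℚ → a ≡ ½
twice⇒½ {a} 2a≡1 = begin
  a             ≡⟨ solve (a ∷ []) ℚ-ring ⟩
  ½ * (a + a)   ≡⟨ cong (½ *_) 2a≡1 ⟩
  ½             ∎
  where open ≡-Reasoning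

½-complement : ∀ {a b} → a + b ≡ 1ℚ → a ≡ ½ → b ≡ ½
½-complement {a} {b} a+b≡1 refl = ∙-cancelˡ ½ b ½ a+b≡1

halves : ∀ {y₀₁ y₁₀ y₁₂ y₂₁ y₂₂ y₃₀} →
         y₁₀ + y₁₂ ≡ 1ℚ → y₂₁ + y₂₂ ≡ 1ℚ →
         y₁₀ + y₃₀ ≡ 1ℚ → y₀₁ + y₂₁ ≡ 1ℚ → y₁₂ + y₂₂ ≡ 1ℚ →
         y₂₁ + y₃₀ ≡ 1ℚ →
         y₀₁ ≡ ½ × y₁₀ ≡ ½ × y₁₂ ≡ ½ × y₂₁ ≡ ½ × y₂₂ ≡ ½ × y₃₀ ≡ ½
halves {y₀₁} {y₁₀} {y₁₂} {y₂₁} {y₂₂} {y₃₀} row₁ row₂ col₀ col₁ col₂ bound =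
  y₀₁≡½ , trans y₁₀≡y₂₁ y₂₁≡½ , trans y₁₂≡y₂₁ y₂₁≡½ , y₂₁≡½ ,
  ½-complement row₂ y₂₁≡½ , ½-complement bound y₂₁≡½
  where
  y₁₀≡y₂₁ : y₁₀ ≡ y₂₁
  y₁₀≡y₂₁ = ∙-cancelʳ y₃₀ y₁₀ y₂₁ (trans col₀ (sym bound))
  y₁₂≡y₂₁ : y₁₂ ≡ y₂₁
  y₁₂≡y₂₁ = ∙-cancelʳ y₂₂ y₁₂ y₂₁ (trans col₂ (sym row₂))
  y₂₁≡½ : y₂₁ ≡ ½
  y₂₁≡½ = twice⇒½ (trans (cong₂ _+_ (sym y₁₀≡y₂₁) (sym y₁₂≡y₂₁)) row₁)
  y₀₁≡½ : y₀₁ ≡ ½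
  y₀₁≡½ = ½-complement (trans (+-comm y₂₁ y₀₁) col₁) y₂₁≡½

-- The sums appear exactly as Σ[_] and load unfold on the support of x½.
x½-system : ∀ {y₀₀ y₀₁ y₀₂ y₁₀ y₁₁ y₁₂ y₂₀ y₂₁ y₂₂ y₃₀ y₃₁ y₃₂} →
  y₀₀ ≡ 0ℚ → y₀₂ ≡ 0ℚ → y₁₁ ≡ 0ℚ → y₂₀ ≡ 0ℚ → y₃₁ ≡ 0ℚ → y₃₂ ≡ 0ℚ →
  y₁₀ + (y₁₁ + (y₁₂ + 0ℚ)) ≡ 1ℚ →
  y₂₀ + (y₂₁ + (y₂₂ + 0ℚ)) ≡ 1ℚ →
  y₀₀ + (y₁₀ + (y₂₀ + (y₃₀ + 0ℚ))) ≡ 1ℚ →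
  y₀₁ + (y₁₁ + (y₂₁ + (y₃₁ + 0ℚ))) ≡ 1ℚ →
  y₀₂ + (y₁₂ + (y₂₂ + (y₃₂ + 0ℚ))) ≡ 1ℚ →
  0ℚ + (0ℚ + ((y₂₀ + (y₂₁ + (0ℚ + 0ℚ))) + ((y₃₀ + (y₃₁ + (0ℚ + 0ℚ))) + 0ℚ))) ≡ 1ℚ →
  y₀₁ ≡ ½ × y₁₀ ≡ ½ × y₁₂ ≡ ½ × y₂₁ ≡ ½ × y₂₂ ≡ ½ × y₃₀ ≡ ½
x½-system {_} {y₀₁} {_} {y₁₀} {_} {y₁₂} {_} {y₂₁} {y₂₂} {y₃₀}
          refl refl refl refl refl refl row₁ row₂ col₀ col₁ col₂ bound =
  halves row₁′ row₂′ col₀′ col₁′ col₂′ bound′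
  where
  open ≡-Reasoning
  row₁′ : y₁₀ + y₁₂ ≡ 1ℚ
  row₁′ = begin
    y₁₀ + y₁₂                  ≡⟨ solve (y₁₀ ∷ y₁₂ ∷ []) ℚ-ring ⟩
    y₁₀ + (0ℚ + (y₁₂ + 0ℚ))    ≡⟨ row₁ ⟩
    1ℚ                         ∎
  row₂′ : y₂₁ + y₂₂ ≡ 1ℚ
  row₂′ = begin
    y₂₁ + y₂₂                  ≡⟨ solve (y₂₁ ∷ y₂₂ ∷ []) ℚ-ring ⟩
    0ℚ + (y₂₁ + (y₂₂ + 0ℚ))    ≡⟨ row₂ ⟩
    1ℚ                         ∎
  col₀′ : y₁₀ + y₃₀ ≡ 1ℚ
  col₀′ = begin
    y₁₀ + y₃₀                         ≡⟨ solve (y₁₀ ∷ y₃₀ ∷ []) ℚ-ring ⟩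
    0ℚ + (y₁₀ + (0ℚ + (y₃₀ + 0ℚ)))    ≡⟨ col₀ ⟩
    1ℚ                                ∎
  col₁′ : y₀₁ + y₂₁ ≡ 1ℚ
  col₁′ = begin
    y₀₁ + y₂₁                         ≡⟨ solve (y₀₁ ∷ y₂₁ ∷ []) ℚ-ring ⟩
    y₀₁ + (0ℚ + (y₂₁ + (0ℚ + 0ℚ)))    ≡⟨ col₁ ⟩
    1ℚ                                ∎
  col₂′ : y₁₂ + y₂₂ ≡ 1ℚ
  col₂′ = begin
    y₁₂ + y₂₂                         ≡⟨ solve (y₁₂ ∷ y₂₂ ∷ []) ℚ-ring ⟩
    0ℚ + (y₁₂ + (y₂₂ + (0ℚ + 0ℚ)))    ≡⟨ col₂ ⟩
    1ℚ                                ∎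
  bound′ : y₂₁ + y₃₀ ≡ 1ℚ
  bound′ = begin
    y₂₁ + y₃₀    ≡⟨ solve (y₂₁ ∷ y₃₀ ∷ []) ℚ-ring ⟩
    0ℚ + (0ℚ + ((0ℚ + (y₂₁ + (0ℚ + 0ℚ))) + ((y₃₀ + (0ℚ + (0ℚ + 0ℚ))) + 0ℚ)))    ≡⟨ bound ⟩
    1ℚ           ∎

example : Instance
example = record
  { m = 4 ; n = 3 ; p = 1 ; n≥1 = s≤s z≤n ; m≥n = s≤s (s≤s (s≤s z≤n))
  ; P = λ _ i → 2 ℕ.≤ᵇ toℕ i
  ; U = bound
  }
  where
  bound : Fin 3 → Fin 1 → ℕ∞
  bound 1F _ = just 1
  bound _  _ = nothing

example-disjoint : Disjoint example
example-disjoint _ 0F 0F _ _ = refl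

x½-support : Fin 4 → Fin 3 → Bool
x½-support 0F 1F = true
x½-support 1F 0F = true
x½-support 1F 2F = true
x½-support 2F 1F = true
x½-support 2F 2F = true
x½-support 3F 0F = true
x½-support _  _  = false

x½ : Matrix 4 3
x½ i j = if x½-support i j then ½ else 0ℚ

decide-≤ : ∀ {p q} → {True (p ≤? q)} → p ≤ q
decide-≤ {_} {_} {t} = toWitness t

x½-inPoly : InPoly example x½
x½-inPoly = (entries , rows , cols) , loads
  where
  entries : ∀ i j → (0ℚ ≤ x½ i j) × (x½ i j ≤ 1ℚ)
  entries i j with x½-support i j
  ... | true  = decide-≤ , decide-≤
  ... | false = decide-≤ , decide-≤
  rows : ∀ i → rowSum example x½ i ≤ 1ℚ
  rows 0F = decide-≤
  rows 1F = decide-≤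
  rows 2F = decide-≤
  rows 3F = decide-≤
  cols : ∀ j → Σ[ 4 ] (λ i → x½ i j) ≡ 1ℚ
  cols 0F = refl
  cols 1F = refl
  cols 2F = refl
  loads : ∀ ℓ k → ≤U (load example x½ ℓ k) (Instance.U example k ℓ)
  loads 0F 0F = tt
  loads 0F 1F = decide-≤
  loads 0F 2F = tt

x½-rigid : ∀ y → InPoly example y → KeepsTight example x½ y → ∀ i j → y i j ≡ x½ i j
x½-rigid y ((_ , _ , col) , _) tight =
  let y₀₁≡½ , y₁₀≡½ , y₁₂≡½ , y₂₁≡½ , y₂₂≡½ , y₃₀≡½ =
        x½-system (zeros 0F 0F refl) (zeros 0F 2F refl) (zeros 1F 1F refl)
                  (zeros 2F 0F refl) (zeros 3F 1F refl) (zeros 3F 2F refl)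
                  (fullRows 1F refl) (fullRows 2F refl) (col 0F) (col 1F) (col 2F)
                  (fullLoads 0F 1F 1 refl refl)
  in λ { 0F 0F → zeros 0F 0F refl ; 0F 1F → y₀₁≡½ ; 0F 2F → zeros 0F 2F refl
       ; 1F 0F → y₁₀≡½ ; 1F 1F → zeros 1F 1F refl ; 1F 2F → y₁₂≡½
       ; 2F 0F → zeros 2F 0F refl ; 2F 1F → y₂₁≡½ ; 2F 2F → y₂₂≡½
       ; 3F 0F → y₃₀≡½ ; 3F 1F → zeros 3F 1F refl ; 3F 2F → zeros 3F 2F refl }
  where
  open KeepsTight tight

fact1 : Σ Instance λ I → Disjoint I ×
    ∃ λ (x : Matrix (Instance.m I) (Instance.n I)) → IsVertex I x × ¬ Integral x
fact1 = example , example-disjoint , x½ , rigid⇒vertex example x½-inPoly x½-rigid ,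
        λ integral → ½-not-integer (proj₁ (integral 0F 1F)) (proj₂ (integral 0F 1F))
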